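{- Let $C_n$ and $C'_m$ ($n,m\ge 3$) be two vertex-disjoint cycles, and let $uv\in E(C_n)$ and $u'v'\in E(C'_m)$. Let $G$ be the graph obtained from $C_n\cup C'_m$ by identifying $u$ with $u'$ and $v$ with $v'$ (so that the edges $uv$ and $u'v'$ become one edge). Then $G\in c$-$\textsc{And}(1)$.
   Context: All graphs are finite, simple and connected. A $c$-$\textsc{And}(1)$-realization of a graph $G=(V,E)$ is a family $\{([L(v),R(v)],p_v):v\in V\}$ of closed real intervals with $p_v=(L(v)+R(v))/2$ such that for distinct $u,v$: $uv\in E$ iff $p_v\in[L(u),R(u)]$ and $p_u\in[L(v),R(v)]$. $c$-$\textsc{And}(1)$ is the class of graphs admitting a $c$-$\textsc{And}(1)$-realization. -}

module Defs where

open import Data.Nat using (ℕ; suc; _+_; _<_; _∸_)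
open import Data.Fin using (Fin; toℕ)
open import Data.Sum using (_⊎_; inj₁; inj₂)
open import Data.Product using (Σ; _×_; ∃; ∃-syntax)
open import Data.Rational using (ℚ; ½) renaming (_+_ to _+ℚ_; _*_ to _*ℚ_; _≤_ to _≤ℚ_)
open import Relation.Binary.PropositionalEquality using (_≡_; _≢_)
open import Function.Bundles using (_⇔_)

record Graph : Set₁ where
  field
    V : Set
    E : V → V → Set
open Graph public

CycSucc : (n : ℕ) → Fin n → Fin n → Set
CycSucc n i j = (toℕ j ≡ suc (toℕ i)) ⊎ ((suc (toℕ i) ≡ n) × (toℕ j ≡ 0))

CycAdj : (n : ℕ) → Fin n → Fin n → Set
CycAdj n i j = CycSucc n i j ⊎ CycSucc n j i

-- The graph obtained from C_n (vertices Fin n, with u = 0, v = 1) and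
-- C'_m (vertices Fin m, with u' = 0, v' = 1) by identifying u with u' and
-- v with v'.  Vertex set: Fin n ⊎ Fin (m ∸ 2), where inj₁ i is vertex i
-- of C_n and inj₂ j is vertex j + 2 of C'_m.
-- Rep m k x : vertex k of C'_m is represented by vertex x of the glued graph.
Rep : (n m : ℕ) → Fin m → Fin n ⊎ Fin (m ∸ 2) → Set
Rep n m k (inj₁ a) = (toℕ k < 2) × (toℕ a ≡ toℕ k)
Rep n m k (inj₂ b) = toℕ k ≡ toℕ b + 2

GlueAdj : (n m : ℕ) → Fin n ⊎ Fin (m ∸ 2) → Fin n ⊎ Fin (m ∸ 2) → Set
GlueAdj n m x y =
  (Σ (Fin n) λ a → Σ (Fin n) λ b → (x ≡ inj₁ a) × (y ≡ inj₁ b) × CycAdj n a b)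
  ⊎ (Σ (Fin m) λ k → Σ (Fin m) λ l → CycAdj m k l × Rep n m k x × Rep n m l y)

GluedCycles : ℕ → ℕ → Graph
GluedCycles n m = record { V = Fin n ⊎ Fin (m ∸ 2) ; E = GlueAdj n m }

_∈[_,_] : ℚ → ℚ → ℚ → Set
x ∈[ a , b ] = (a ≤ℚ x) × (x ≤ℚ b)

record CAnd1Realization (G : Graph) : Set where
  field
    L R : V G → ℚ
    L≤R : ∀ v → L v ≤ℚ R v
  p : V G → ℚ
  p v = ½ *ℚ (L v +ℚ R v)
  field
    realizes : ∀ u v → u ≢ v →
      E G u v ⇔ ((p v ∈[ L u , R u ]) × (p u ∈[ L v , R v ]))

CAnd1 : Graph → Set
CAnd1 G = CAnd1Realization G

{-# OPTIONS --safe #-}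
-- Give every vertex x an integer centre c x and a radius r x, i.e. the interval
-- [c x - r x , c x + r x]; then x and y are adjacent in the realised graph iff
-- |c x - c y| ≤ min (r x) (r y).  Let D = n - 1.  The vertices of C′ₘ, read along the path
-- C′ₘ - vw from the neighbour w of v (vertex 2 of C′ₘ) to v, go to 0, D, 2D, …, so that u and v
-- land at S = (m - 2) D and T = S + D.  They all get radius D, except v and w, which get radius
-- T: among them exactly the path neighbours see each other, and v and w, the only pair whose
-- radii both span the whole line.  The other vertices of Cₙ fill the gap between v and u at
-- unit steps with radius 1, so each of them sees exactly its two neighbours on Cₙ, and nothing
-- at distance ≥ D.
module Submission where

open import Defs
open import Data.Nat using (ℕ; zero; suc; _+_; _∸_; _*_; _⊓_; _≤_; _<_; z≤n; s≤s; ∣_-_∣)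
import Data.Nat.Properties as ℕ
open import Data.Fin using (Fin; zero; suc; toℕ)
import Data.Fin.Properties as Fin
open import Data.Integer as ℤ using (+_)
import Data.Integer.Properties as ℤ
open import Data.Rational as ℚ using (ℚ; ½) renaming (_≤_ to _≤ℚ_)
open import Data.Rational.Literals using (fromℤ)
import Data.Rational.Properties as ℚ
import Data.Rational.Unnormalised as ℚᵘ
import Data.Rational.Unnormalised.Properties as ℚᵘ
open import Data.Rational.Solver using (module +-*-Solver)
open import Data.Empty using (⊥-elim)
open import Data.Product using (_×_; _,_)
open import Data.Product.Function.NonDependent.Propositional using (_×-⇔_)
open import Data.Sum as Sum using (_⊎_; inj₁; inj₂)
open import Function using (_∘_)
open import Function.Bundles using (_⇔_; mk⇔; Equivalence)
open import Function.Definitions using (Injective)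
import Function.Properties.Equivalence as ⇔
open import Relation.Binary.PropositionalEquality

toℚ : ℕ → ℚ
toℚ n = fromℤ (+ n)

toℚ-+ : ∀ m n → toℚ (m + n) ≡ toℚ m ℚ.+ toℚ n
toℚ-+ m n = ℚ.toℚᵘ-injective
  (ℚᵘ.≃-trans (ℚᵘ.*≡* numerators) (ℚᵘ.≃-sym (ℚ.toℚᵘ-homo-+ (toℚ m) (toℚ n))))
  where
  open ≡-Reasoning
  numerators : + (m + n) ℤ.* + 1 ≡ (+ m ℤ.* + 1 ℤ.+ + n ℤ.* + 1) ℤ.* + 1
  numerators = begin
    + (m + n) ℤ.* + 1                  ≡⟨ ℤ.*-identityʳ _ ⟩
    + (m + n)                          ≡⟨ ℤ.pos-+ m n ⟩
    + m ℤ.+ + n                        ≡⟨ cong₂ ℤ._+_ (ℤ.*-identityʳ (+ m)) (ℤ.*-identityʳ (+ n)) ⟨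
    + m ℤ.* + 1 ℤ.+ + n ℤ.* + 1        ≡⟨ ℤ.*-identityʳ _ ⟨
    (+ m ℤ.* + 1 ℤ.+ + n ℤ.* + 1) ℤ.* + 1 ∎

toℚ-mono-≤ : ∀ {m n} → m ≤ n → toℚ m ≤ℚ toℚ n
toℚ-mono-≤ {m} {n} m≤n =
  ℚ.*≤* (subst₂ ℤ._≤_ (sym (ℤ.*-identityʳ (+ m))) (sym (ℤ.*-identityʳ (+ n))) (ℤ.+≤+ m≤n))

toℚ-cancel-≤ : ∀ {m n} → toℚ m ≤ℚ toℚ n → m ≤ n
toℚ-cancel-≤ {m} {n} (ℚ.*≤* le) =
  ℤ.drop‿+≤+ (subst₂ ℤ._≤_ (ℤ.*-identityʳ (+ m)) (ℤ.*-identityʳ (+ n)) le)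

private
  open +-*-Solver

  -+-cancel : ∀ p r → (p ℚ.- r) ℚ.+ r ≡ p
  -+-cancel = solve 2 (λ p r → (p :- r) :+ r := p) refl

  +--cancel : ∀ p r → (p ℚ.+ r) ℚ.- r ≡ p
  +--cancel = solve 2 (λ p r → (p :+ r) :- r := p) refl

  midpoint : ∀ p r → ½ ℚ.* ((p ℚ.- r) ℚ.+ (p ℚ.+ r)) ≡ p
  midpoint = solve 2 (λ p r → con ½ :* ((p :- r) :+ (p :+ r)) := p) refl

∈-centred⇔ : ∀ p q r → q ∈[ p ℚ.- r , p ℚ.+ r ] ⇔ (p ≤ℚ q ℚ.+ r × q ≤ℚ p ℚ.+ r)
∈-centred⇔ p q r = mk⇔ (λ (l , u) → -≤⇒≤+ l , u) (λ (l , u) → ≤+⇒-≤ l , u)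
  where
  -≤⇒≤+ : p ℚ.- r ≤ℚ q → p ≤ℚ q ℚ.+ r
  -≤⇒≤+ h = subst (_≤ℚ q ℚ.+ r) (-+-cancel p r) (ℚ.+-monoˡ-≤ r h)
  ≤+⇒-≤ : p ≤ℚ q ℚ.+ r → p ℚ.- r ≤ℚ q
  ≤+⇒-≤ h = subst (p ℚ.- r ≤ℚ_) (+--cancel q r) (ℚ.+-monoˡ-≤ (ℚ.- r) h)

∣m-n∣≤o⇔ : ∀ m n o → ∣ m - n ∣ ≤ o ⇔ (m ≤ n + o × n ≤ m + o)
∣m-n∣≤o⇔ m n o = mk⇔ to from
  where
  to : ∣ m - n ∣ ≤ o → m ≤ n + o × n ≤ m + o
  to h = ℕ.≤-trans (ℕ.m≤n+∣m-n∣ m n) (ℕ.+-monoʳ-≤ n h)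
       , ℕ.≤-trans (ℕ.m≤n+∣n-m∣ n m) (ℕ.+-monoʳ-≤ m h)
  from : m ≤ n + o × n ≤ m + o → ∣ m - n ∣ ≤ o
  from (m≤n+o , n≤m+o) with ℕ.∣m-n∣≡[m∸n]∨[n∸m] m n
  ... | inj₁ eq = subst (_≤ o) (sym eq) (ℕ.m≤n+o⇒m∸n≤o m n m≤n+o)
  ... | inj₂ eq = subst (_≤ o) (sym eq) (ℕ.m≤n+o⇒m∸n≤o n m n≤m+o)

toℚ-∈-centred⇔ : ∀ m n o → toℚ n ∈[ toℚ m ℚ.- toℚ o , toℚ m ℚ.+ toℚ o ] ⇔ ∣ m - n ∣ ≤ o
toℚ-∈-centred⇔ m n o =
  ⇔.trans (∈-centred⇔ (toℚ m) (toℚ n) (toℚ o)) (⇔.trans cast (⇔.sym (∣m-n∣≤o⇔ m n o)))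
  where
  cast : ∀ {a b c d} →
    (toℚ a ≤ℚ toℚ b ℚ.+ toℚ c × toℚ d ≤ℚ toℚ a ℚ.+ toℚ c) ⇔ (a ≤ b + c × d ≤ a + c)
  cast {a} {b} {c} {d} = mk⇔
    (λ (l , u) → toℚ-cancel-≤ (subst (toℚ a ≤ℚ_) (sym (toℚ-+ b c)) l)
               , toℚ-cancel-≤ (subst (toℚ d ≤ℚ_) (sym (toℚ-+ a c)) u))
    (λ (l , u) → subst (toℚ a ≤ℚ_) (toℚ-+ b c) (toℚ-mono-≤ l)
               , subst (toℚ d ≤ℚ_) (toℚ-+ a c) (toℚ-mono-≤ u))

≤⊓⇔ : ∀ m n o → m ≤ n ⊓ o ⇔ (m ≤ n × m ≤ o)
≤⊓⇔ m n o = mk⇔ (λ h → ℕ.m≤n⊓o⇒m≤n n o h , ℕ.m≤n⊓o⇒m≤o n o h) (λ (l , r) → ℕ.⊓-glb l r)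

ball-realization : (G : Graph) (centre radius : V G → ℕ) →
  (∀ x y → x ≢ y → E G x y ⇔ (∣ centre x - centre y ∣ ≤ radius x ⊓ radius y)) → CAnd1 G
ball-realization G c ρ adjacent⇔ = record
  { L = L
  ; R = R
  ; L≤R = λ x →
      let (l , u) = Equivalence.from (covers x x) (subst (_≤ ρ x) (sym (ℕ.∣n-n∣≡0 (c x))) z≤n)
      in ℚ.≤-trans l u
  ; realizes = λ x y x≢y →
      ⇔.trans (adjacent⇔ x y x≢y) (⇔.trans (≤⊓⇔ _ (ρ x) (ρ y)) (⇔.sym (covers x y ×-⇔ covered-by x y)))
  }
  where
  L R : V G → ℚ
  L x = toℚ (c x) ℚ.- toℚ (ρ x)
  R x = toℚ (c x) ℚ.+ toℚ (ρ x)
  covers : ∀ x y → (½ ℚ.* (L y ℚ.+ R y)) ∈[ L x , R x ] ⇔ ∣ c x - c y ∣ ≤ ρ x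
  covers x y =
    subst (λ q → q ∈[ L x , R x ] ⇔ ∣ c x - c y ∣ ≤ ρ x) (sym (midpoint (toℚ (c y)) (toℚ (ρ y))))
          (toℚ-∈-centred⇔ (c x) (c y) (ρ x))
  covered-by : ∀ x y → (½ ℚ.* (L x ℚ.+ R x)) ∈[ L y , R y ] ⇔ ∣ c x - c y ∣ ≤ ρ y
  covered-by x y =
    subst (λ d → (½ ℚ.* (L x ℚ.+ R x)) ∈[ L y , R y ] ⇔ d ≤ ρ y) (ℕ.∣-∣-comm (c y) (c x)) (covers y x)

∣m-n∣≤1⇒n≡1+m⊎m≡1+n : ∀ {m n} → m ≢ n → ∣ m - n ∣ ≤ 1 → n ≡ suc m ⊎ m ≡ suc n
∣m-n∣≤1⇒n≡1+m⊎m≡1+n {zero}        {zero}        m≢n _       = ⊥-elim (m≢n refl)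
∣m-n∣≤1⇒n≡1+m⊎m≡1+n {zero}        {suc zero}    _   _       = inj₁ refl
∣m-n∣≤1⇒n≡1+m⊎m≡1+n {suc zero}    {zero}        _   _       = inj₂ refl
∣m-n∣≤1⇒n≡1+m⊎m≡1+n {suc m}       {suc n}       m≢n ∣m-n∣≤1 =
  Sum.map (cong suc) (cong suc) (∣m-n∣≤1⇒n≡1+m⊎m≡1+n (m≢n ∘ cong suc) ∣m-n∣≤1)
∣m-n∣≤1⇒n≡1+m⊎m≡1+n {zero}        {suc (suc _)} _   (s≤s ())
∣m-n∣≤1⇒n≡1+m⊎m≡1+n {suc (suc _)} {zero}        _   (s≤s ())

∣o∸m-o∸n∣≡∣m-n∣ : ∀ {m n o} → m ≤ o → n ≤ o → ∣ o ∸ m - o ∸ n ∣ ≡ ∣ m - n ∣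
∣o∸m-o∸n∣≡∣m-n∣ {o = o} z≤n z≤n = ℕ.∣n-n∣≡0 o
∣o∸m-o∸n∣≡∣m-n∣ (s≤s m≤o) (s≤s n≤o) = ∣o∸m-o∸n∣≡∣m-n∣ m≤o n≤o
∣o∸m-o∸n∣≡∣m-n∣ z≤n (s≤s {n} {o} n≤o) = begin
  ∣ suc o - o ∸ n ∣  ≡⟨ ℕ.m≤n⇒∣n-m∣≡n∸m (ℕ.m≤n⇒m≤1+n (ℕ.m∸n≤m o n)) ⟩
  suc o ∸ (o ∸ n)    ≡⟨ ℕ.+-∸-assoc 1 (ℕ.m∸n≤m o n) ⟩
  suc (o ∸ (o ∸ n))  ≡⟨ cong suc (ℕ.m∸[m∸n]≡n n≤o) ⟩
  suc n              ∎
  where open ≡-Reasoning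
∣o∸m-o∸n∣≡∣m-n∣ {m} {o = o} m≤o@(s≤s _) z≤n =
  trans (ℕ.∣-∣-comm (o ∸ m) o) (∣o∸m-o∸n∣≡∣m-n∣ z≤n m≤o)

∣n-1+n∣≡1 : ∀ n → ∣ n - suc n ∣ ≡ 1
∣n-1+n∣≡1 zero    = refl
∣n-1+n∣≡1 (suc n) = ∣n-1+n∣≡1 n

∣f-f∣≤1⇒cycAdj : ∀ {n} (f : Fin n → ℕ) → Injective _≡_ _≡_ f →
  (∀ {a b} → f b ≡ suc (f a) → CycSucc n a b) →
  ∀ {a b} → a ≢ b → ∣ f a - f b ∣ ≤ 1 → CycAdj n a b
∣f-f∣≤1⇒cycAdj f f-injective suc⇒cycSucc a≢b close =
  Sum.map suc⇒cycSucc suc⇒cycSucc (∣m-n∣≤1⇒n≡1+m⊎m≡1+n (a≢b ∘ f-injective) close)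

glueAdj-sym : ∀ {n m x y} → GlueAdj n m x y → GlueAdj n m y x
glueAdj-sym (inj₁ (a , b , x≡a , y≡b , adj)) = inj₁ (b , a , y≡b , x≡a , Sum.swap adj)
glueAdj-sym (inj₂ (i , i′ , adj , ri , ri′)) = inj₂ (i′ , i , Sum.swap adj , ri′ , ri)

pattern 𝐮 = inj₁ zero
pattern 𝐯 = inj₁ (suc zero)
pattern 𝐚 t = inj₁ (suc (suc t))
pattern 𝐛 j = inj₂ j

module Layout (k l : ℕ) where

  n m : ℕ
  n = 3 + k
  m = 3 + l

  Vertex : Set
  Vertex = V (GluedCycles n m)

  D S T : ℕ
  D = 2 + k
  S = suc l * D
  T = suc (suc l) * D

  -- Cₙ - uv and C′ₘ - vw are paths, numbered by depth from v and by height from w.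
  depth : Fin n → ℕ
  depth zero          = D
  depth (suc zero)    = 0
  depth (suc (suc t)) = suc (toℕ t)

  height : Fin m → ℕ
  height zero          = suc l
  height (suc zero)    = suc (suc l)
  height (suc (suc j)) = toℕ j

  rep : Fin m → Vertex
  rep zero          = 𝐮
  rep (suc zero)    = 𝐯
  rep (suc (suc j)) = 𝐛 j

  centre : Vertex → ℕ
  centre (inj₁ a) = T ∸ depth a
  centre (inj₂ j) = toℕ j * D

  radius : Vertex → ℕ
  radius 𝐮             = D
  radius 𝐯             = T
  radius (𝐚 _)         = 1
  radius (𝐛 zero)      = T
  radius (𝐛 (suc _))   = D

  distance : Vertex → Vertex → ℕ
  distance x y = ∣ centre x - centre y ∣

  Close : Vertex → Vertex → Set
  Close x y = distance x y ≤ radius x ⊓ radius y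

  Rep-rep : ∀ i → Rep n m i (rep i)
  Rep-rep zero          = s≤s z≤n , refl
  Rep-rep (suc zero)    = s≤s (s≤s z≤n) , refl
  Rep-rep (suc (suc j)) = ℕ.+-comm 2 (toℕ j)

  Rep⇒≡rep : ∀ {i x} → Rep n m i x → x ≡ rep i
  Rep⇒≡rep {zero}        {inj₁ _} (_ , eq) = cong inj₁ (Fin.toℕ-injective eq)
  Rep⇒≡rep {suc zero}    {inj₁ _} (_ , eq) = cong inj₁ (Fin.toℕ-injective eq)
  Rep⇒≡rep {suc (suc _)} {inj₁ _} (s≤s (s≤s ()) , _)
  Rep⇒≡rep {zero}        {inj₂ j} eq with () ← trans eq (ℕ.+-comm (toℕ j) 2)
  Rep⇒≡rep {suc zero}    {inj₂ j} eq with () ← trans eq (ℕ.+-comm (toℕ j) 2)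
  Rep⇒≡rep {suc (suc i)} {inj₂ j} eq =
    cong inj₂ (Fin.toℕ-injective (ℕ.suc-injective (ℕ.suc-injective (trans (ℕ.+-comm 2 (toℕ j)) (sym eq)))))

  depth<D : ∀ t → depth (suc (suc t)) < D
  depth<D t = s≤s (s≤s (Fin.toℕ≤pred[n] t))

  depth≤D : ∀ a → depth a ≤ D
  depth≤D zero          = ℕ.≤-refl
  depth≤D (suc zero)    = z≤n
  depth≤D (suc (suc t)) = ℕ.<⇒≤ (depth<D t)

  depth-injective : Injective _≡_ _≡_ depth
  depth-injective {zero}        {zero}         _  = refl
  depth-injective {suc zero}    {suc zero}     _  = refl
  depth-injective {suc (suc _)} {suc (suc _)}  eq = Fin.toℕ-injective (cong suc eq)
  depth-injective {zero}        {suc (suc t)}  eq = ⊥-elim (ℕ.<-irrefl (sym eq) (depth<D t))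
  depth-injective {suc (suc t)} {zero}         eq = ⊥-elim (ℕ.<-irrefl eq (depth<D t))
  depth-injective {zero}        {suc zero}     ()
  depth-injective {suc zero}    {zero}         ()
  depth-injective {suc zero}    {suc (suc _)}  ()
  depth-injective {suc (suc _)} {suc zero}     ()

  suc-depth⇒cycSucc : ∀ {a b} → depth b ≡ suc (depth a) → CycSucc n a b
  suc-depth⇒cycSucc {zero}        {b}           eq = ⊥-elim (ℕ.<-irrefl refl (subst (_≤ D) eq (depth≤D b)))
  suc-depth⇒cycSucc {suc (suc _)} {zero}        eq = inj₂ (cong suc (sym eq) , refl)
  suc-depth⇒cycSucc {suc zero}    {suc (suc _)} eq = inj₁ (cong suc eq)
  suc-depth⇒cycSucc {suc (suc _)} {suc (suc _)} eq = inj₁ (cong suc eq)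
  suc-depth⇒cycSucc {suc zero}    {zero}        ()
  suc-depth⇒cycSucc {suc _}       {suc zero}    ()

  cycSucc⇒suc-depth⊎uv : ∀ {a b} → CycSucc n a b →
    depth b ≡ suc (depth a) ⊎ (a ≡ zero × b ≡ suc zero)
  cycSucc⇒suc-depth⊎uv {zero}        {suc zero}    (inj₁ refl)      = inj₂ (refl , refl)
  cycSucc⇒suc-depth⊎uv {suc zero}    {suc (suc _)} (inj₁ eq)        = inj₁ (ℕ.suc-injective eq)
  cycSucc⇒suc-depth⊎uv {suc (suc _)} {suc (suc _)} (inj₁ eq)        = inj₁ (ℕ.suc-injective eq)
  cycSucc⇒suc-depth⊎uv {suc (suc _)} {zero}        (inj₂ (eq , _))  = inj₁ (sym (ℕ.suc-injective eq))
  cycSucc⇒suc-depth⊎uv {_}           {zero}        (inj₁ ())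
  cycSucc⇒suc-depth⊎uv {zero}        {suc (suc _)} (inj₁ ())
  cycSucc⇒suc-depth⊎uv {suc zero}    {suc zero}    (inj₁ ())
  cycSucc⇒suc-depth⊎uv {suc (suc _)} {suc zero}    (inj₁ ())
  cycSucc⇒suc-depth⊎uv {zero}        {_}           (inj₂ (() , _))
  cycSucc⇒suc-depth⊎uv {suc zero}    {_}           (inj₂ (() , _))
  cycSucc⇒suc-depth⊎uv {_}           {suc _}       (inj₂ (_ , ()))

  height≤ : ∀ i → height i ≤ suc (suc l)
  height≤ zero          = ℕ.n≤1+n (suc l)
  height≤ (suc zero)    = ℕ.≤-refl
  height≤ (suc (suc j)) = ℕ.m≤n⇒m≤1+n (ℕ.<⇒≤ (Fin.toℕ<n j))

  height-injective : Injective _≡_ _≡_ height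
  height-injective {zero}        {zero}        _  = refl
  height-injective {suc zero}    {suc zero}    _  = refl
  height-injective {suc (suc _)} {suc (suc _)} eq = Fin.toℕ-injective (cong (λ i → suc (suc i)) eq)
  height-injective {zero}        {suc zero}    eq = ⊥-elim (ℕ.1+n≢n (sym eq))
  height-injective {suc zero}    {zero}        eq = ⊥-elim (ℕ.1+n≢n eq)
  height-injective {zero}        {suc (suc j)} eq = ⊥-elim (ℕ.<-irrefl (sym eq) (Fin.toℕ<n j))
  height-injective {suc (suc j)} {zero}        eq = ⊥-elim (ℕ.<-irrefl eq (Fin.toℕ<n j))
  height-injective {suc zero}    {suc (suc j)} eq = ⊥-elim (ℕ.<-irrefl (sym eq) (ℕ.m<n⇒m<1+n (Fin.toℕ<n j)))
  height-injective {suc (suc j)} {suc zero}    eq = ⊥-elim (ℕ.<-irrefl eq (ℕ.m<n⇒m<1+n (Fin.toℕ<n j)))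

  suc-height⇒cycSucc : ∀ {i i′} → height i′ ≡ suc (height i) → CycSucc m i i′
  suc-height⇒cycSucc {zero}        {suc zero}     _  = inj₁ refl
  suc-height⇒cycSucc {suc (suc _)} {zero}         eq = inj₂ (cong (λ i → suc (suc i)) (sym eq) , refl)
  suc-height⇒cycSucc {suc (suc _)} {suc (suc _)}  eq = inj₁ (cong (λ i → suc (suc i)) eq)
  suc-height⇒cycSucc {suc zero}    {i′}           eq =
    ⊥-elim (ℕ.<-irrefl refl (subst (_≤ suc (suc l)) eq (height≤ i′)))
  suc-height⇒cycSucc {zero}        {zero}         eq = ⊥-elim (ℕ.1+n≢n (sym eq))
  suc-height⇒cycSucc {zero}        {suc (suc j)}  eq = ⊥-elim (ℕ.<-irrefl eq (ℕ.m<n⇒m<1+n (Fin.toℕ<n j)))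
  suc-height⇒cycSucc {suc (suc j)} {suc zero}     eq =
    ⊥-elim (ℕ.<-irrefl (ℕ.suc-injective (sym eq)) (Fin.toℕ<n j))

  cycSucc⇒suc-height⊎vb : ∀ {i i′} → CycSucc m i i′ →
    height i′ ≡ suc (height i) ⊎ (i ≡ suc zero × i′ ≡ suc (suc zero))
  cycSucc⇒suc-height⊎vb {zero}        {suc zero}          (inj₁ _)        = inj₁ refl
  cycSucc⇒suc-height⊎vb {suc zero}    {suc (suc zero)}    (inj₁ _)        = inj₂ (refl , refl)
  cycSucc⇒suc-height⊎vb {suc (suc _)} {suc (suc _)}       (inj₁ eq)       =
    inj₁ (ℕ.suc-injective (ℕ.suc-injective eq))
  cycSucc⇒suc-height⊎vb {suc (suc _)} {zero}              (inj₂ (eq , _)) =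
    inj₁ (sym (ℕ.suc-injective (ℕ.suc-injective eq)))
  cycSucc⇒suc-height⊎vb {_}           {zero}              (inj₁ ())
  cycSucc⇒suc-height⊎vb {zero}        {suc (suc _)}       (inj₁ ())
  cycSucc⇒suc-height⊎vb {suc zero}    {suc zero}          (inj₁ ())
  cycSucc⇒suc-height⊎vb {suc zero}    {suc (suc (suc _))} (inj₁ ())
  cycSucc⇒suc-height⊎vb {suc (suc _)} {suc zero}          (inj₁ ())
  cycSucc⇒suc-height⊎vb {zero}        {_}                 (inj₂ (() , _))
  cycSucc⇒suc-height⊎vb {suc zero}    {_}                 (inj₂ (() , _))
  cycSucc⇒suc-height⊎vb {_}           {suc _}             (inj₂ (_ , ()))

  distance-inj₁ : ∀ a b → distance (inj₁ a) (inj₁ b) ≡ ∣ depth a - depth b ∣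
  distance-inj₁ a b = ∣o∸m-o∸n∣≡∣m-n∣ (depth≤T a) (depth≤T b)
    where
    depth≤T : ∀ a → depth a ≤ T
    depth≤T a = ℕ.≤-trans (depth≤D a) (ℕ.m≤m+n D S)

  centre-rep : ∀ i → centre (rep i) ≡ height i * D
  centre-rep zero          = ℕ.m+n∸m≡n D S
  centre-rep (suc zero)    = refl
  centre-rep (suc (suc _)) = refl

  distance-rep : ∀ i i′ → distance (rep i) (rep i′) ≡ ∣ height i - height i′ ∣ * D
  distance-rep i i′ =
    trans (cong₂ ∣_-_∣ (centre-rep i) (centre-rep i′)) (sym (ℕ.*-distribʳ-∣-∣ D (height i) (height i′)))

  D≤distance-inj₁-𝐛 : ∀ a j → D ≤ distance (inj₁ a) (𝐛 j)
  D≤distance-inj₁-𝐛 a j =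
    ℕ.≤-trans (ℕ.m+n≤o⇒m≤o∸n D 𝐛+D≤inj₁) (ℕ.m∸n≤∣m-n∣ (centre (inj₁ a)) (centre (𝐛 j)))
    where
    open ℕ.≤-Reasoning
    𝐛+D≤inj₁ : D + centre (𝐛 j) ≤ centre (inj₁ a)
    𝐛+D≤inj₁ = begin
      suc (toℕ j) * D  ≤⟨ ℕ.*-monoˡ-≤ D (Fin.toℕ<n j) ⟩
      S                ≡⟨ ℕ.m+n∸m≡n D S ⟨
      T ∸ D            ≤⟨ ℕ.∸-monoʳ-≤ T (depth≤D a) ⟩
      T ∸ depth a      ∎

  1≤radius : ∀ x → 1 ≤ radius x
  1≤radius 𝐮           = s≤s z≤n
  1≤radius 𝐯           = s≤s z≤n
  1≤radius (𝐚 _)       = s≤s z≤n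
  1≤radius (𝐛 zero)    = s≤s z≤n
  1≤radius (𝐛 (suc _)) = s≤s z≤n

  D≤radius-rep : ∀ i → D ≤ radius (rep i)
  D≤radius-rep zero                = ℕ.≤-refl
  D≤radius-rep (suc zero)          = ℕ.m≤m+n D S
  D≤radius-rep (suc (suc zero))    = ℕ.m≤m+n D S
  D≤radius-rep (suc (suc (suc _))) = ℕ.≤-refl

  Long : Fin m → Set
  Long i = i ≡ suc zero ⊎ i ≡ suc (suc zero)

  radius-rep : ∀ i → radius (rep i) ≡ D ⊎ Long i
  radius-rep zero                = inj₁ refl
  radius-rep (suc zero)          = inj₂ (inj₁ refl)
  radius-rep (suc (suc zero))    = inj₂ (inj₂ refl)
  radius-rep (suc (suc (suc _))) = inj₁ refl

  close-sym : ∀ x y → Close x y → Close y x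
  close-sym x y = subst₂ _≤_ (ℕ.∣-∣-comm (centre x) (centre y)) (ℕ.⊓-comm (radius x) (radius y))

  cycSucc⇒close-inj₁ : ∀ {a b} → CycSucc n a b → Close (inj₁ a) (inj₁ b)
  cycSucc⇒close-inj₁ {a} {b} s with cycSucc⇒suc-depth⊎uv s
  ... | inj₁ eq = begin
    distance (inj₁ a) (inj₁ b)      ≡⟨ distance-inj₁ a b ⟩
    ∣ depth a - depth b ∣           ≡⟨ cong ∣ depth a -_∣ eq ⟩
    ∣ depth a - suc (depth a) ∣     ≡⟨ ∣n-1+n∣≡1 (depth a) ⟩
    1                               ≤⟨ ℕ.⊓-glb (1≤radius (inj₁ a)) (1≤radius (inj₁ b)) ⟩
    radius (inj₁ a) ⊓ radius (inj₁ b) ∎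
    where open ℕ.≤-Reasoning
  ... | inj₂ (refl , refl) =
    subst (_≤ D ⊓ T) (sym (distance-inj₁ zero (suc zero))) (ℕ.⊓-glb ℕ.≤-refl (ℕ.m≤m+n D S))

  cycSucc⇒close-rep : ∀ {i i′} → CycSucc m i i′ → Close (rep i) (rep i′)
  cycSucc⇒close-rep {i} {i′} s with cycSucc⇒suc-height⊎vb s
  ... | inj₁ eq = begin
    distance (rep i) (rep i′)              ≡⟨ distance-rep i i′ ⟩
    ∣ height i - height i′ ∣ * D           ≡⟨ cong (λ h → ∣ height i - h ∣ * D) eq ⟩
    ∣ height i - suc (height i) ∣ * D      ≡⟨ cong (_* D) (∣n-1+n∣≡1 (height i)) ⟩
    1 * D                                  ≡⟨ ℕ.*-identityˡ D ⟩
    D                                      ≤⟨ ℕ.⊓-glb (D≤radius-rep i) (D≤radius-rep i′) ⟩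
    radius (rep i) ⊓ radius (rep i′)       ∎
    where open ℕ.≤-Reasoning
  ... | inj₂ (refl , refl) = ℕ.⊓-glb ℕ.≤-refl ℕ.≤-refl

  adjacent⇒close : ∀ {x y} → GlueAdj n m x y → Close x y
  adjacent⇒close (inj₁ (a , b , refl , refl , adj)) =
    Sum.[ cycSucc⇒close-inj₁ , close-sym (inj₁ b) (inj₁ a) ∘ cycSucc⇒close-inj₁ ] adj
  adjacent⇒close (inj₂ (i , i′ , adj , ri , ri′)) with Rep⇒≡rep ri | Rep⇒≡rep ri′
  ... | refl | refl = Sum.[ cycSucc⇒close-rep , close-sym (rep i′) (rep i) ∘ cycSucc⇒close-rep ] adj

  close-𝐚⇒adjacent : ∀ t y → 𝐚 t ≢ y → distance (𝐚 t) y ≤ 1 → GlueAdj n m (𝐚 t) y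
  close-𝐚⇒adjacent t (inj₁ b) 𝐚≢b close = inj₁ (_ , b , refl , refl , adj)
    where
    adj : CycAdj n (suc (suc t)) b
    adj = ∣f-f∣≤1⇒cycAdj depth depth-injective suc-depth⇒cycSucc (𝐚≢b ∘ cong inj₁)
            (subst (_≤ 1) (distance-inj₁ (suc (suc t)) b) close)
  close-𝐚⇒adjacent t (𝐛 j) _ close with ℕ.≤-trans (D≤distance-inj₁-𝐛 (suc (suc t)) j) close
  ... | s≤s ()

  long-adjacent : ∀ {i i′} → i ≢ i′ → Long i → Long i′ → CycAdj m i i′
  long-adjacent i≢i′ (inj₁ refl) (inj₁ refl) = ⊥-elim (i≢i′ refl)
  long-adjacent _    (inj₁ refl) (inj₂ refl) = inj₁ (inj₁ refl)
  long-adjacent _    (inj₂ refl) (inj₁ refl) = inj₂ (inj₁ refl)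
  long-adjacent i≢i′ (inj₂ refl) (inj₂ refl) = ⊥-elim (i≢i′ refl)

  distance-rep≤D⇒cycAdj : ∀ i i′ → i ≢ i′ → distance (rep i) (rep i′) ≤ D → CycAdj m i i′
  distance-rep≤D⇒cycAdj i i′ i≢i′ h = ∣f-f∣≤1⇒cycAdj height height-injective suc-height⇒cycSucc i≢i′
    (ℕ.*-cancelʳ-≤ _ 1 D (subst₂ _≤_ (distance-rep i i′) (sym (ℕ.*-identityˡ D)) h))

  close-rep⇒cycAdj : ∀ i i′ → i ≢ i′ → Close (rep i) (rep i′) → CycAdj m i i′
  close-rep⇒cycAdj i i′ i≢i′ close with radius-rep i | radius-rep i′
  ... | inj₁ r≡D | _        =
    distance-rep≤D⇒cycAdj i i′ i≢i′ (ℕ.≤-trans close (ℕ.≤-trans (ℕ.m⊓n≤m _ _) (ℕ.≤-reflexive r≡D)))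
  ... | _        | inj₁ r≡D =
    distance-rep≤D⇒cycAdj i i′ i≢i′ (ℕ.≤-trans close (ℕ.≤-trans (ℕ.m⊓n≤n _ _) (ℕ.≤-reflexive r≡D)))
  ... | inj₂ li  | inj₂ li′ = long-adjacent i≢i′ li li′

  data Side : Vertex → Set where
    Cₙ-only : ∀ t → Side (𝐚 t)
    C′ₘ     : ∀ i → Side (rep i)

  side : ∀ x → Side x
  side 𝐮     = C′ₘ zero
  side 𝐯     = C′ₘ (suc zero)
  side (𝐚 t) = Cₙ-only t
  side (𝐛 j) = C′ₘ (suc (suc j))

  close⇒adjacent : ∀ {x y} → x ≢ y → Close x y → GlueAdj n m x y
  close⇒adjacent {x} {y} x≢y close with side x | side y
  ... | Cₙ-only t | _ = close-𝐚⇒adjacent t y x≢y (ℕ.≤-trans close (ℕ.m⊓n≤m 1 (radius y)))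
  ... | C′ₘ i | Cₙ-only t = glueAdj-sym (close-𝐚⇒adjacent t (rep i) (x≢y ∘ sym)
                              (ℕ.≤-trans (close-sym (rep i) (𝐚 t) close) (ℕ.m⊓n≤m 1 (radius (rep i)))))
  ... | C′ₘ i | C′ₘ i′ =
    inj₂ (i , i′ , close-rep⇒cycAdj i i′ (x≢y ∘ cong rep) close , Rep-rep i , Rep-rep i′)

  realization : CAnd1 (GluedCycles n m)
  realization = ball-realization (GluedCycles n m) centre radius
                  (λ x y x≢y → mk⇔ adjacent⇒close (close⇒adjacent x≢y))

lemma3 : (n m : ℕ) → 3 ≤ n → 3 ≤ m → CAnd1 (GluedCycles n m)
lemma3 _ _ (s≤s (s≤s (s≤s _))) (s≤s (s≤s (s≤s _))) = Layout.realization _ _
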